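{- If $G$ is a triangle-free gap-critical graph, then every connected component of $G$ is factor-critical and has odd order at least $5$.
   Context: All graphs are finite, simple and undirected. $\alpha(G)$ denotes the maximum size of a stable set, $\theta(G)$ the minimum number of cliques partitioning $V(G)$, and $\mathrm{gap}(G)=\theta(G)-\alpha(G)$. A graph $G$ is gap-critical if $\mathrm{gap}(H)<\mathrm{gap}(G)$ for every proper induced subgraph $H$ of $G$. A graph is factor-critical if deleting any single vertex leaves a graph with a perfect matching (a one-vertex graph counts as factor-critical). -}

module Defs where

open import Data.Nat using (ℕ; _<_)
open import Data.Integer using (ℤ; +_; _-_) renaming (_<_ to _<ℤ_)
open import Data.Bool using (Bool; true; false; _∧_; not)
open import Data.Empty using (⊥)
open import Data.Fin using (Fin)
open import Data.Fin.Subset using (Subset; _∈_; _∉_; _⊆_; ∣_∣; ⊤; _─_; ⁅_⁆)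
open import Data.Product using (Σ; _×_; ∃)
open import Relation.Binary.PropositionalEquality using (_≡_; _≢_)
open import Relation.Nullary using (¬_)

record Graph : Set where
  field
    n     : ℕ
    adj   : Fin n → Fin n → Bool
    sym   : ∀ u v → adj u v ≡ adj v u
    irref : ∀ u → adj u u ≡ false
open Graph public

module _ (G : Graph) where

  StableIn : Subset (n G) → Subset (n G) → Set
  StableIn U S = S ⊆ U × (∀ u v → u ∈ S → v ∈ S → adj G u v ≡ false)

  IsAlpha : Subset (n G) → ℕ → Set
  IsAlpha U a = Σ (Subset (n G)) (λ S → StableIn U S × ∣ S ∣ ≡ a)
              × (∀ S → StableIn U S → ∣ S ∣ Data.Nat.≤ a)

  -- A partition of U into (at most) k cliques, given by a labelling of U by k labels
  -- whose classes are cliques.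
  CliquePartition : Subset (n G) → ℕ → Set
  CliquePartition U k =
    Σ ((u : Fin (n G)) → u ∈ U → Fin k) λ c →
      ∀ u v (hu : u ∈ U) (hv : v ∈ U) → u ≢ v → c u hu ≡ c v hv → adj G u v ≡ true

  IsTheta : Subset (n G) → ℕ → Set
  IsTheta U t = CliquePartition U t × (∀ k → CliquePartition U k → t Data.Nat.≤ k)

  IsGap : Subset (n G) → ℤ → Set
  IsGap U g = Σ ℕ λ t → Σ ℕ λ a → IsTheta U t × IsAlpha U a × g ≡ (+ t) - (+ a)

  GapCritical : Set
  GapCritical = ∀ U → ¬ (⊤ ⊆ U) → ∀ g gU → IsGap ⊤ g → IsGap U gU → gU <ℤ g

  TriangleFree : Set
  TriangleFree = ∀ u v w → adj G u v ≡ true → adj G v w ≡ true → adj G u w ≡ true → ⊥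

  data WalkIn (C : Subset (n G)) : Fin (n G) → Fin (n G) → Set where
    here : ∀ {u} → u ∈ C → WalkIn C u u
    step : ∀ {u v w} → u ∈ C → adj G u v ≡ true → WalkIn C v w → WalkIn C u w

  -- C is (the vertex set of) a connected component of G: nonempty,
  -- connected, and no edge leaves C (hence maximal connected).
  IsComponent : Subset (n G) → Set
  IsComponent C = (∃ λ v → v ∈ C)
                × (∀ u v → u ∈ C → v ∈ C → WalkIn C u v)
                × (∀ u v → u ∈ C → adj G u v ≡ true → v ∈ C)

  -- m restricted to W is a perfect matching of G[W]: a fixed-point-free involution
  -- of W pairing each vertex with a neighbour.
  PerfectMatching : Subset (n G) → Set
  PerfectMatching W = Σ (Fin (n G) → Fin (n G)) λ m →
    ∀ w → w ∈ W → (m w ∈ W) × (adj G w (m w) ≡ true) × (m (m w) ≡ w)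

  FactorCritical : Subset (n G) → Set
  FactorCritical C = ∀ x → x ∈ C → PerfectMatching (C ─ ⁅ x ⁆)

-- A triangle-free graph has only cliques of size at most two, so its clique covers are matchings:
-- a matching with d exposed vertices covers G by (|G| + d)/2 cliques, and conversely.  Deleting a
-- vertex x cannot raise α, so gap-criticality forces θ(G - x) < θ(G); a minimum clique cover of
-- G - x together with the singleton {x} is then a maximum matching of G missing x.  Every vertex is
-- thus missed by some maximum matching, and Gallai's lemma makes every component factor-critical,
-- hence of odd order.  An isolated vertex would leave the gap unchanged, and a factor-critical
-- graph on three vertices is a triangle, so every component has at least five vertices.
module Submission where

open import Data.Bool using (Bool; true; false; _∧_; not; if_then_else_)
import Data.Bool as Bool
open import Data.Bool.Properties using (∧-identityʳ; ∧-zeroʳ; ∧-conicalˡ; ∧-conicalʳ)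
open import Data.Empty using (⊥; ⊥-elim)
open import Data.Fin as Fin using (Fin; zero; suc)
open import Data.Fin.Permutation using (permutation)
import Data.Fin.Properties as Finₚ
open import Data.Fin.Subset using (Subset; _∈_; _∉_; _⊆_; _∪_; _-_; ∣_∣; ⁅_⁆; ⊤; Nonempty)
  renaming (⊥ to ∅)
open import Data.Fin.Subset.Properties
  using (_∈?_; _⊆?_; anySubset?; ∈⊤; ∉⊥; ⊆-min; ∣p∣≤n; ∣⊥∣≡0; p─⊥≡p; p─q⊆p; x∈p∧x≢y⇒x∈p-y;
         p⊂q⇒∣p∣<∣q∣; p⊆p∪q; q⊆p∪q; x∈p∪q⁻; x∈⁅x⁆; x∈⁅y⁆⇒x≡y)
import Data.Integer as ℤ
import Data.Integer.Properties as ℤₚ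
open import Data.Integer.Solver using () renaming (module +-*-Solver to ℤ-Solver)
open import Data.Nat as ℕ using (ℕ; zero; suc; _+_; _≤_; _<_; z≤n; s≤s; s≤s⁻¹; _%_)
open import Data.Nat.Induction using (<-wellFounded)
open import Data.Nat.Properties
open import Algebra.Properties.CommutativeMonoid.Sum +-0-commutativeMonoid
  using (sum; sum-cong-≗; sum-permute; ∑-distrib-+)
open import Algebra.Properties.CommutativeSemigroup +-commutativeSemigroup using (x∙yz≈y∙xz)
open import Data.Product using (Σ; ∃; _×_; _,_; proj₁; proj₂)
open import Data.Sum using (_⊎_; inj₁; inj₂)
open import Data.Vec using ([]; _∷_; lookup; here; there)
open import Data.Vec.Functional using (updateAt)
open import Data.Vec.Functional.Properties using (updateAt-updates; updateAt-minimal)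
open import Data.Vec.Properties using ([]=⇒lookup; lookup⇒[]=)
open import Function using (_∘_; const)
open import Induction.WellFounded using (Acc; acc)
open import Relation.Binary.Definitions using (tri<; tri≈; tri>)
open import Relation.Binary.PropositionalEquality
open import Relation.Nullary using (¬_; Dec; yes; no; does)
open import Relation.Nullary.Decidable
  using (dec-true; dec-false; decidable-stable; map′; ¬?; _×-dec_; _→-dec_)
import Relation.Unary as U

open import Defs hiding (sym)

does-true⁻ : ∀ {A : Set} (a? : Dec A) → does a? ≡ true → A
does-true⁻ (yes a) _ = a

does-false⁻ : ∀ {A : Set} (a? : Dec A) → does a? ≡ false → ¬ A
does-false⁻ (no ¬a) _ = ¬a

minimal : ∀ {P : ℕ → Set} → U.Decidable P → ∀ {b} → P b → ∃ λ k → P k × (∀ j → P j → k ≤ j)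
minimal {P} P? {b} Pb = go (<-wellFounded b) Pb
  where
  go : ∀ {b} → Acc _<_ b → P b → ∃ λ k → P k × (∀ j → P j → k ≤ j)
  go {b} (acc smaller) Pb with anyUpTo? P? b
  ... | yes (j , j<b , Pj) = go (smaller j<b) Pj
  ... | no ∄j              = b , Pb , λ j Pj → ≮⇒≥ (λ j<b → ∄j (j , j<b , Pj))

maximal : ∀ {P : ℕ → Set} → U.Decidable P → ∀ B → (∀ j → P j → j ≤ B) →
  ∀ {b} → P b → ∃ λ k → P k × (∀ j → P j → j ≤ k)
maximal P? B bounded Pb with P? B
... | yes PB = B , PB , bounded
maximal {P} P? zero    bounded {b} Pb | no ¬PB = ⊥-elim (¬PB (subst P (n≤0⇒n≡0 (bounded b Pb)) Pb))
maximal     P? (suc B) bounded     Pb | no ¬PB =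
  maximal P? B (λ j Pj → s≤s⁻¹ (≤∧≢⇒< (bounded j Pj) (λ { refl → ¬PB Pj }))) Pb

any-function? : ∀ n {k} {P : (Fin n → Fin k) → Set} → (∀ {f g} → f ≗ g → P f → P g) →
  U.Decidable P → Dec (∃ P)
any-function? zero resp P? with P? (λ ())
... | yes Pf = yes (_ , Pf)
... | no ¬Pf = no λ (f , Pf) → ¬Pf (resp (λ ()) Pf)
any-function? (suc n) {k} {P} resp P?
  with Finₚ.any? (λ a → any-function? n (resp ∘ cons-cong) (P? ∘ cons a))
  where
  cons : Fin k → (Fin n → Fin k) → Fin (suc n) → Fin k
  cons a f zero    = a
  cons a f (suc i) = f i
  cons-cong : ∀ {a f g} → f ≗ g → cons a f ≗ cons a g
  cons-cong f≗g zero    = refl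
  cons-cong f≗g (suc i) = f≗g i
... | yes (a , f , Pf) = yes (_ , Pf)
... | no ∄ = no λ (f , Pf) → ∄ (f zero , f ∘ suc , resp (λ { zero → refl ; (suc i) → refl }) Pf)

bit : Bool → ℕ
bit true  = 1
bit false = 0

bit-mono : ∀ {a b} → (a ≡ true → b ≡ true) → bit a ≤ bit b
bit-mono {false}         _   = z≤n
bit-mono {true}  {true}  _   = ≤-refl
bit-mono {true}  {false} a⇒b with () ← a⇒b refl

module _ {n : ℕ} where

  count : (Fin n → Bool) → ℕ
  count p = sum (bit ∘ p)

  infix 4 _⊆ᵇ_
  _⊆ᵇ_ : (Fin n → Bool) → (Fin n → Bool) → Set
  p ⊆ᵇ q = ∀ i → p i ≡ true → q i ≡ true

  remove : (Fin n → Bool) → Fin n → Fin n → Bool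
  remove p w i = p i ∧ not (does (i Finₚ.≟ w))

  remove⁺ : ∀ p w {i} → p i ≡ true → i ≢ w → remove p w i ≡ true
  remove⁺ p w {i} pi i≢w rewrite pi | dec-false (i Finₚ.≟ w) i≢w = refl

  remove⁻ : ∀ p w {i} → remove p w i ≡ true → p i ≡ true × i ≢ w
  remove⁻ p w {i} r with p i | i Finₚ.≟ w
  ... | true  | no i≢w = refl , i≢w
  ... | true  | yes _  with () ← r
  ... | false | _      with () ← r

  remove-mono : ∀ {p q} w → p ⊆ᵇ q → remove p w ⊆ᵇ remove q w
  remove-mono {p} {q} w p⊆q i r = let pi , i≢w = remove⁻ p w r in remove⁺ q w (p⊆q i pi) i≢w

count-cong : ∀ {n} {p q : Fin n → Bool} → (∀ i → p i ≡ q i) → count p ≡ count q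
count-cong p≗q = sum-cong-≗ (cong bit ∘ p≗q)

count-mono : ∀ {n} (p q : Fin n → Bool) → p ⊆ᵇ q → count p ≤ count q
count-mono {zero}  _ _ _   = z≤n
count-mono {suc n} p q p⊆q = +-mono-≤ (bit-mono (p⊆q zero)) (count-mono (p ∘ suc) (q ∘ suc) (p⊆q ∘ suc))

count-const-true : ∀ n → count {n} (const true) ≡ n
count-const-true zero    = refl
count-const-true (suc n) = cong suc (count-const-true n)

count-const-false : ∀ n → count {n} (const false) ≡ 0
count-const-false zero    = refl
count-const-false (suc n) = count-const-false n

count-remove-bit : ∀ {n} (p : Fin n → Bool) w → count p ≡ bit (p w) + count (remove p w)
count-remove-bit {suc n} p zero = cong (bit (p zero) +_) (cong₂ _+_
  (cong bit (sym (∧-zeroʳ (p zero))))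
  (count-cong λ i → sym (∧-identityʳ (p (suc i)))))
count-remove-bit {suc n} p (suc w) = begin
  bit (p zero) + count (p ∘ suc)                    ≡⟨ cong (bit (p zero) +_) (count-remove-bit (p ∘ suc) w) ⟩
  bit (p zero) + (bit (p (suc w)) + count p′)       ≡⟨ x∙yz≈y∙xz (bit (p zero)) (bit (p (suc w))) (count p′) ⟩
  bit (p (suc w)) + (bit (p zero) + count p′)       ≡⟨ cong (λ b → bit (p (suc w)) + (bit b + count p′))
                                                            (∧-identityʳ (p zero)) ⟨
  bit (p (suc w)) + count (remove p (suc w))        ∎
  where
  open ≡-Reasoning
  p′ = remove (p ∘ suc) w

count-remove : ∀ {n} (p : Fin n → Bool) {w} → p w ≡ true → count p ≡ suc (count (remove p w))
count-remove p {w} pw = trans (count-remove-bit p w) (cong (λ b → bit b + count (remove p w)) pw)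

count-remove-≤ : ∀ {n} (p : Fin n → Bool) w → count p ≤ suc (count (remove p w))
count-remove-≤ p w = begin
  count p                        ≡⟨ count-remove-bit p w ⟩
  bit (p w) + count (remove p w) ≤⟨ +-monoˡ-≤ _ (bit-mono {b = true} (const refl)) ⟩
  suc (count (remove p w))       ∎
  where open ≤-Reasoning

count-< : ∀ {n} (p q : Fin n → Bool) {w} → p ⊆ᵇ q → p w ≡ false → q w ≡ true → count p < count q
count-< p q {w} p⊆q pw qw = begin-strict
  count p                        ≡⟨ count-remove-bit p w ⟩
  bit (p w) + count (remove p w) ≡⟨ cong (λ b → bit b + count (remove p w)) pw ⟩
  count (remove p w)             ≤⟨ count-mono (remove p w) (remove q w) (remove-mono w p⊆q) ⟩
  count (remove q w)             <⟨ n<1+n _ ⟩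
  suc (count (remove q w))       ≡⟨ count-remove q qw ⟨
  count q                        ∎
  where open ≤-Reasoning

injective-on⇒count≤ : ∀ {n} k (p : Fin n → Bool) (f : Fin n → ℕ) →
  (∀ i → p i ≡ true → f i < k) →
  (∀ i j → p i ≡ true → p j ≡ true → f i ≡ f j → i ≡ j) → count p ≤ k
injective-on⇒count≤ {n} zero p f f<0 _ =
  ≤-trans (count-mono p (const false) (λ i pi → ⊥-elim (n≮0 (f<0 i pi)))) (≤-reflexive (count-const-false n))
injective-on⇒count≤ (suc k) p f f<1+k f-inj
  with Finₚ.any? (λ i → (p i Bool.≟ true) ×-dec (f i ℕ.≟ k))
... | yes (i₀ , pi₀ , fi₀≡k) = begin
  count p                   ≡⟨ count-remove p pi₀ ⟩
  suc (count (remove p i₀)) ≤⟨ s≤s (injective-on⇒count≤ k (remove p i₀) f f<k injective-on-remove) ⟩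
  suc k                     ∎
  where
  open ≤-Reasoning
  injective-on-remove : ∀ i j → remove p i₀ i ≡ true → remove p i₀ j ≡ true → f i ≡ f j → i ≡ j
  injective-on-remove i j ri rj = f-inj i j (proj₁ (remove⁻ p i₀ ri)) (proj₁ (remove⁻ p i₀ rj))
  f<k : ∀ i → remove p i₀ i ≡ true → f i < k
  f<k i ri = let pi , i≢i₀ = remove⁻ p i₀ ri in
    ≤∧≢⇒< (s≤s⁻¹ (f<1+k i pi)) (λ fi≡k → i≢i₀ (f-inj i i₀ pi pi₀ (trans fi≡k (sym fi₀≡k))))
... | no ∄i₀ = m≤n⇒m≤1+n (injective-on⇒count≤ k p f f<k f-inj)
  where
  f<k : ∀ i → p i ≡ true → f i < k
  f<k i pi = ≤∧≢⇒< (s≤s⁻¹ (f<1+k i pi)) (λ fi≡k → ∄i₀ (i , pi , fi≡k))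

rank : ∀ {n} → (Fin n → Bool) → Fin n → ℕ
rank p i = count (λ j → p j ∧ does (j Finₚ.<? i))

rank-< : ∀ {n} (p : Fin n → Bool) {i j} → p i ≡ true → i Fin.< j → rank p i < rank p j
rank-< p {i} {j} pi i<j = count-< _ _ before-i⊆before-j i∉before-i i∈before-j
  where
  before-i⊆before-j : (λ k → p k ∧ does (k Finₚ.<? i)) ⊆ᵇ (λ k → p k ∧ does (k Finₚ.<? j))
  before-i⊆before-j k e = cong₂ _∧_ (∧-conicalˡ _ _ e)
    (dec-true (k Finₚ.<? j) (Finₚ.<-trans (does-true⁻ (k Finₚ.<? i) (∧-conicalʳ _ _ e)) i<j))
  i∉before-i : p i ∧ does (i Finₚ.<? i) ≡ false
  i∉before-i rewrite pi = dec-false (i Finₚ.<? i) (Finₚ.<-irrefl refl)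
  i∈before-j : p i ∧ does (i Finₚ.<? j) ≡ true
  i∈before-j rewrite pi = dec-true (i Finₚ.<? j) i<j

rank<count : ∀ {n} (p : Fin n → Bool) {i} → p i ≡ true → rank p i < count p
rank<count p {i} pi = count-< _ p (λ k → ∧-conicalˡ _ _) i∉before-i pi
  where
  i∉before-i : p i ∧ does (i Finₚ.<? i) ≡ false
  i∉before-i rewrite pi = dec-false (i Finₚ.<? i) (Finₚ.<-irrefl refl)

rank-injective : ∀ {n} (p : Fin n → Bool) {i j : Fin n} → p i ≡ true → p j ≡ true →
  rank p i ≡ rank p j → i ≡ j
rank-injective p {i} {j} pi pj e with Finₚ.<-cmp i j
... | tri< i<j _ _ = ⊥-elim (<⇒≢ (rank-< p pi i<j) e)
... | tri≈ _ i≡j _ = i≡j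
... | tri> _ _ j<i = ⊥-elim (<⇒≢ (rank-< p pj j<i) (sym e))

pair-bits : ∀ {n} (i j : Fin n) →
  bit (does (i Finₚ.≤? j)) + bit (does (j Finₚ.≤? i)) ≡ suc (bit (does (j Finₚ.≟ i)))
pair-bits i j with Finₚ.<-cmp i j
... | tri< i<j _ _
  rewrite dec-true (i Finₚ.≤? j) (<⇒≤ i<j) | dec-false (j Finₚ.≤? i) (<⇒≱ i<j)
        | dec-false (j Finₚ.≟ i) (Finₚ.<⇒≢ i<j ∘ sym) = refl
... | tri≈ _ refl _
  rewrite dec-true (i Finₚ.≤? i) ≤-refl | dec-true (i Finₚ.≟ i) refl = refl
... | tri> _ _ j<i
  rewrite dec-false (i Finₚ.≤? j) (<⇒≱ j<i) | dec-true (j Finₚ.≤? i) (<⇒≤ j<i)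
        | dec-false (j Finₚ.≟ i) (Finₚ.<⇒≢ j<i) = refl

module _ {n : ℕ} where
  open import Algebra.Definitions {A = Fin n} _≡_ using (Involutive)

  fixed : (Fin n → Fin n) → Fin n → Bool
  fixed m i = does (m i Finₚ.≟ i)

  lower : (Fin n → Fin n) → Fin n → Bool
  lower m i = does (i Finₚ.≤? m i)

  count-∘-involution : ∀ {m} → Involutive m → (p : Fin n → Bool) → count (p ∘ m) ≡ count p
  count-∘-involution {m} m-inv p = sym (sum-permute (bit ∘ p) (permutation m m m-inv m-inv))

  count-lower-twice : ∀ {m} → Involutive m → (s : Fin n → Bool) → (∀ i → s (m i) ≡ s i) →
    let sl = λ i → s i ∧ lower m i in
    count sl + count sl ≡ count s + count (λ i → s i ∧ fixed m i)
  count-lower-twice {m} m-inv s s-closed = begin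
    count sl + count sl                           ≡⟨ cong (count sl +_) (count-∘-involution m-inv sl) ⟨
    count sl + count (sl ∘ m)                     ≡⟨ ∑-distrib-+ (bit ∘ sl) (bit ∘ sl ∘ m) ⟨
    sum (λ i → bit (sl i) + bit (sl (m i)))       ≡⟨ sum-cong-≗ pointwise ⟩
    sum (λ i → bit (s i) + bit (s i ∧ fixed m i)) ≡⟨ ∑-distrib-+ (bit ∘ s) _ ⟩
    count s + count (λ i → s i ∧ fixed m i)       ∎
    where
    open ≡-Reasoning
    sl = λ i → s i ∧ lower m i
    pointwise : ∀ i → bit (sl i) + bit (sl (m i)) ≡ bit (s i) + bit (s i ∧ fixed m i)
    pointwise i rewrite s-closed i | m-inv i with s i
    ... | true  = pair-bits i (m i)
    ... | false = refl

  count-lower+count-lower : ∀ {m} → Involutive m → count (lower m) + count (lower m) ≡ n + count (fixed m)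
  count-lower+count-lower {m} m-inv = trans (count-lower-twice m-inv (const true) (λ _ → refl))
                                            (cong (_+ count (fixed m)) (count-const-true n))

  -- Read as a matching with a exposed: a is matched to b, and the former partner of b is exposed.
  link : (Fin n → Fin n) → Fin n → Fin n → Fin n → Fin n
  link m a b = updateAt (updateAt (updateAt m (m b) (const (m b))) a (const b)) b (const a)

  module _ {m : Fin n → Fin n} {a b : Fin n} where

    link-b : link m a b b ≡ a
    link-b = updateAt-updates b _

    link-a : a ≢ b → link m a b a ≡ b
    link-a a≢b = trans (updateAt-minimal a b _ a≢b) (updateAt-updates a _)

    link-orphan : ∀ {i} → i ≢ a → i ≢ b → i ≡ m b → link m a b i ≡ i
    link-orphan {i} i≢a i≢b refl =
      trans (updateAt-minimal i b _ i≢b) (trans (updateAt-minimal i a _ i≢a) (updateAt-updates i m))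

    link-other : ∀ {i} → i ≢ a → i ≢ b → i ≢ m b → link m a b i ≡ m i
    link-other {i} i≢a i≢b i≢mb = trans (updateAt-minimal i b _ i≢b)
      (trans (updateAt-minimal i a _ i≢a) (updateAt-minimal i (m b) m i≢mb))

    link-involutive : Involutive m → m a ≡ a → a ≢ b → Involutive (link m a b)
    link-involutive m-inv ma≡a a≢b i with i Finₚ.≟ b | i Finₚ.≟ a | i Finₚ.≟ m b
    ... | yes refl | _        | _        = trans (cong (link m a b) link-b) (link-a a≢b)
    ... | no _     | yes refl | _        = trans (cong (link m a b) (link-a a≢b)) link-b
    ... | no i≢b   | no i≢a   | yes i≡mb = trans (cong (link m a b) ri≡i) ri≡i
      where ri≡i = link-orphan i≢a i≢b i≡mb
    ... | no i≢b   | no i≢a   | no i≢mb  =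
      trans (cong (link m a b) (link-other i≢a i≢b i≢mb)) (trans (link-other mi≢a mi≢b mi≢mb) (m-inv i))
      where
      m-injective : ∀ {j k} → m j ≡ m k → j ≡ k
      m-injective {j} {k} e = trans (sym (m-inv j)) (trans (cong m e) (m-inv k))
      mi≢a : m i ≢ a
      mi≢a e = i≢a (m-injective (trans e (sym ma≡a)))
      mi≢b : m i ≢ b
      mi≢b e = i≢mb (trans (sym (m-inv i)) (cong m e))
      mi≢mb : m i ≢ m b
      mi≢mb e = i≢b (m-injective e)

    link-fixed : a ≢ b → ∀ {i} → fixed (link m a b) i ≡ true →
      i ≢ a × i ≢ b × (i ≡ m b ⊎ fixed m i ≡ true)
    link-fixed a≢b {i} e = i≢a , i≢b , orphan-or-fixed
      where
      ri≡i : link m a b i ≡ i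
      ri≡i = does-true⁻ (link m a b i Finₚ.≟ i) e
      i≢a : i ≢ a
      i≢a refl = a≢b (trans (sym ri≡i) (link-a a≢b))
      i≢b : i ≢ b
      i≢b refl = a≢b (trans (sym link-b) ri≡i)
      orphan-or-fixed : i ≡ m b ⊎ fixed m i ≡ true
      orphan-or-fixed with i Finₚ.≟ m b
      ... | yes i≡mb = inj₁ i≡mb
      ... | no i≢mb  = inj₂ (dec-true (m i Finₚ.≟ i) (trans (sym (link-other i≢a i≢b i≢mb)) ri≡i))

x∈p-y⇒x≢y : ∀ {n} {p : Subset n} {x y} → x ∈ p - y → x ≢ y
x∈p-y⇒x≢y {p = true  ∷ _} {zero}  {zero}  () refl
x∈p-y⇒x≢y {p = false ∷ _} {zero}  {zero}  () refl
x∈p-y⇒x≢y {p = _ ∷ p}     {suc x} {suc y} (there x∈p-y) refl = x∈p-y⇒x≢y {p = p} x∈p-y refl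

∣p∣≡1+∣p-x∣ : ∀ {n} {p : Subset n} {x} → x ∈ p → ∣ p ∣ ≡ suc ∣ p - x ∣
∣p∣≡1+∣p-x∣ {p = true  ∷ p} {zero}  here        = cong (suc ∘ ∣_∣) (sym (p─⊥≡p p))
∣p∣≡1+∣p-x∣ {p = true  ∷ p} {suc x} (there x∈p) = cong suc (∣p∣≡1+∣p-x∣ x∈p)
∣p∣≡1+∣p-x∣ {p = false ∷ p} {suc x} (there x∈p) = ∣p∣≡1+∣p-x∣ x∈p

∣p∣≡count-lookup : ∀ {n} (p : Subset n) → ∣ p ∣ ≡ count (lookup p)
∣p∣≡count-lookup []          = refl
∣p∣≡count-lookup (true  ∷ p) = cong suc (∣p∣≡count-lookup p)
∣p∣≡count-lookup (false ∷ p) = ∣p∣≡count-lookup p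

nonempty : ∀ {n} (p : Subset n) → 0 < ∣ p ∣ → Nonempty p
nonempty (true  ∷ p) _     = zero , here
nonempty (false ∷ p) 0<∣p∣ = let x , x∈p = nonempty p 0<∣p∣ in suc x , there x∈p

∣p∣≡3⇒third-element : ∀ {n} {p : Subset n} {x y z} → x ∈ p → y ∈ p - x → z ∈ p - x - y → ∣ p ∣ ≡ 3 →
  ∀ {w} → w ∈ p → w ≢ x → w ≢ y → w ≡ z
∣p∣≡3⇒third-element {p = p} {x} {y} {z} x∈p y∈p-x z∈p-x-y ∣p∣≡3 {w} w∈p w≢x w≢y =
  decidable-stable (w Finₚ.≟ z) λ w≢z → <-irrefl (sym ∣p∣≡3) (begin-strict
    3                     <⟨ +-monoʳ-< 3 (0<∣p-x-y-z∣ w≢z) ⟩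
    3 + ∣ p - x - y - z ∣ ≡⟨ cong (2 +_) (∣p∣≡1+∣p-x∣ z∈p-x-y) ⟨
    2 + ∣ p - x - y ∣     ≡⟨ cong suc (∣p∣≡1+∣p-x∣ y∈p-x) ⟨
    1 + ∣ p - x ∣         ≡⟨ ∣p∣≡1+∣p-x∣ x∈p ⟨
    ∣ p ∣                 ∎)
  where
  open ≤-Reasoning
  0<∣p-x-y-z∣ : w ≢ z → 0 < ∣ p - x - y - z ∣
  0<∣p-x-y-z∣ w≢z = subst (0 <_) (sym (∣p∣≡1+∣p-x∣ w∈p-x-y-z)) (s≤s z≤n)
    where w∈p-x-y-z = x∈p∧x≢y⇒x∈p-y (x∈p∧x≢y⇒x∈p-y (x∈p∧x≢y⇒x∈p-y w∈p w≢x) w≢y) w≢z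

-<-⇒+<+ : ∀ {t a t′ a′} → ℤ.+ t′ ℤ.- ℤ.+ a′ ℤ.< ℤ.+ t ℤ.- ℤ.+ a → t′ + a < t + a′
-<-⇒+<+ {t} {a} {t′} {a′} gap< = ℤₚ.drop‿+<+ (subst₂ ℤ._<_
  (trans (cancelˡ (ℤ.+ t′) (ℤ.+ a′) (ℤ.+ a)) (sym (ℤₚ.pos-+ t′ a)))
  (trans (cancelʳ (ℤ.+ t) (ℤ.+ a) (ℤ.+ a′)) (sym (ℤₚ.pos-+ t a′)))
  (ℤₚ.+-monoˡ-< (ℤ.+ a ℤ.+ ℤ.+ a′) gap<))
  where
  open ℤ-Solver
  cancelˡ : ∀ x y z → (x ℤ.- y) ℤ.+ (z ℤ.+ y) ≡ x ℤ.+ z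
  cancelˡ = solve 3 (λ x y z → (x :- y) :+ (z :+ y) := x :+ z) refl
  cancelʳ : ∀ x y z → (x ℤ.- y) ℤ.+ (y ℤ.+ z) ≡ x ℤ.+ z
  cancelʳ = solve 3 (λ x y z → (x :- y) :+ (y :+ z) := x :+ z) refl

module _ (G : Graph) where
  open import Algebra.Definitions {A = Fin (n G)} _≡_ using (Involutive)

  adj-sym : ∀ {u v} → adj G u v ≡ true → adj G v u ≡ true
  adj-sym {u} {v} uv = trans (Graph.sym G v u) uv

  adj⇒≢ : ∀ {u v} → adj G u v ≡ true → u ≢ v
  adj⇒≢ {u} uu refl with () ← trans (sym (irref G u)) uu

  -- Matchings

  -- A matching is encoded as an involution; its fixed points are the exposed vertices.
  record IsMatching (m : Fin (n G) → Fin (n G)) : Set where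
    field
      involutive : Involutive m
      adjacent   : ∀ i → m i ≢ i → adj G i (m i) ≡ true

  deficiency : (Fin (n G) → Fin (n G)) → ℕ
  deficiency m = count (fixed m)

  record IsMaximumMatching (m : Fin (n G) → Fin (n G)) : Set where
    field
      isMatching : IsMatching m
      maximum    : ∀ {m′} → IsMatching m′ → deficiency m ≤ deficiency m′
    open IsMatching isMatching public

  Inessential : Fin (n G) → Set
  Inessential w = ∃ λ Q → IsMaximumMatching Q × Q w ≡ w

  link-isMatching : ∀ {m a b} → IsMatching m → m a ≡ a → adj G a b ≡ true → IsMatching (link m a b)
  link-isMatching {m} {a} {b} M ma≡a ab = record
    { involutive = link-involutive (IsMatching.involutive M) ma≡a (adj⇒≢ ab)
    ; adjacent   = adjacent
    }
    where
    adjacent : ∀ i → link m a b i ≢ i → adj G i (link m a b i) ≡ true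
    adjacent i ri≢i with i Finₚ.≟ b | i Finₚ.≟ a | i Finₚ.≟ m b
    ... | yes refl | _        | _        = subst (λ j → adj G b j ≡ true) (sym link-b) (adj-sym ab)
    ... | no _     | yes refl | _        = subst (λ j → adj G a j ≡ true) (sym (link-a (adj⇒≢ ab))) ab
    ... | no i≢b   | no i≢a   | yes i≡mb = ⊥-elim (ri≢i (link-orphan i≢a i≢b i≡mb))
    ... | no i≢b   | no i≢a   | no i≢mb  = subst (λ j → adj G i j ≡ true) (sym ri≡mi)
      (IsMatching.adjacent M i (λ mi≡i → ri≢i (trans ri≡mi mi≡i)))
      where ri≡mi = link-other i≢a i≢b i≢mb

  maximum-matching-no-exposed-edge : ∀ {m u v} → IsMaximumMatching m →
    m u ≡ u → m v ≡ v → adj G u v ≡ true → ⊥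
  maximum-matching-no-exposed-edge {m} {u} {v} M mu≡u mv≡v uv = <⇒≱ fewer-exposed
    (IsMaximumMatching.maximum M (link-isMatching (IsMaximumMatching.isMatching M) mu≡u uv))
    where
    u≢v = adj⇒≢ uv
    exposed⊆ : fixed (link m u v) ⊆ᵇ fixed m
    exposed⊆ i e with link-fixed u≢v e
    ... | _ , i≢v , inj₁ i≡mv = ⊥-elim (i≢v (trans i≡mv mv≡v))
    ... | _ , _   , inj₂ mi≡i = mi≡i
    fewer-exposed : deficiency (link m u v) < deficiency m
    fewer-exposed = count-< (fixed (link m u v)) (fixed m) exposed⊆
      (dec-false (link m u v u Finₚ.≟ u) (λ ru≡u → u≢v (trans (sym ru≡u) (link-a u≢v))))
      (dec-true (m u Finₚ.≟ u) mu≡u)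

  disagree : (Fin (n G) → Fin (n G)) → (Fin (n G) → Fin (n G)) → Fin (n G) → Bool
  disagree P Q i = not (does (Q i Finₚ.≟ P i))

  module Exchange {P Q : Fin (n G) → Fin (n G)} (P-matching : IsMatching P)
                  (Q-maximum : IsMaximumMatching Q) {x} (Qx≡x : Q x ≡ x) (Px≢x : P x ≢ x)
                  (QPx≢Px : Q (P x) ≢ P x) where
    private
      module P = IsMatching P-matching
      module Q = IsMaximumMatching Q-maximum
      y = P x
      z = Q y
      Q′ = link Q x y
      x≢y : x ≢ y
      x≢y = Px≢x ∘ sym
      Qz≡y : Q z ≡ y
      Qz≡y = Q.involutive y
      Py≡x : P y ≡ x
      Py≡x = P.involutive x
      z≢x : z ≢ x
      z≢x z≡x = QPx≢Px (trans z≡x (trans (sym Qx≡x) (trans (cong Q (sym z≡x)) Qz≡y)))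

    exchange-maximum : IsMaximumMatching (link Q x (P x))
    exchange-maximum = record
      { isMatching = link-isMatching Q.isMatching Qx≡x (P.adjacent x Px≢x)
      ; maximum    = λ M → ≤-trans no-more-exposed (Q.maximum M)
      }
      where
      exposed⊆ : remove (fixed Q′) z ⊆ᵇ remove (fixed Q) x
      exposed⊆ i e with remove⁻ (fixed Q′) z e
      ... | Q′i≡i , i≢z with link-fixed x≢y Q′i≡i
      ...   | i≢x , _ , inj₁ i≡z  = ⊥-elim (i≢z i≡z)
      ...   | i≢x , _ , inj₂ Qi≡i = remove⁺ (fixed Q) x Qi≡i i≢x
      no-more-exposed : deficiency Q′ ≤ deficiency Q
      no-more-exposed = begin
        count (fixed Q′)                  ≤⟨ count-remove-≤ (fixed Q′) z ⟩
        suc (count (remove (fixed Q′) z)) ≤⟨ s≤s (count-mono _ _ exposed⊆) ⟩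
        suc (count (remove (fixed Q) x))  ≡⟨ count-remove (fixed Q) (dec-true (Q x Finₚ.≟ x) Qx≡x) ⟨
        count (fixed Q)                   ∎
        where open ≤-Reasoning

    exchange-keeps-exposed : ∀ {w} → Q w ≡ w → w ≢ x → link Q x (P x) w ≡ w
    exchange-keeps-exposed {w} Qw≡w w≢x = trans (link-other w≢x w≢y w≢z) Qw≡w
      where
      w≢y : w ≢ y
      w≢y refl = QPx≢Px Qw≡w
      w≢z : w ≢ z
      w≢z refl = QPx≢Px (trans (sym Qw≡w) Qz≡y)

    exchange-closer : count (disagree P (link Q x (P x))) < count (disagree P Q)
    exchange-closer = count-< (disagree P Q′) (disagree P Q) disagreement⊆ agree-at-x disagree-at-x
      where
      agree-at-x : disagree P Q′ x ≡ false
      agree-at-x = cong not (dec-true (Q′ x Finₚ.≟ y) (link-a x≢y))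
      disagree-at-x : disagree P Q x ≡ true
      disagree-at-x = cong not (dec-false (Q x Finₚ.≟ y) (λ Qx≡y → x≢y (trans (sym Qx≡x) Qx≡y)))
      agree-at-y : disagree P Q′ y ≡ false
      agree-at-y = cong not (dec-true (Q′ y Finₚ.≟ P y) (trans link-b (sym Py≡x)))
      disagree-at-z : disagree P Q z ≡ true
      disagree-at-z = cong not (dec-false (Q z Finₚ.≟ P z) λ Qz≡Pz →
        z≢x (trans (sym (P.involutive z)) (trans (cong P (trans (sym Qz≡Pz) Qz≡y)) Py≡x)))
      disagreement⊆ : disagree P Q′ ⊆ᵇ disagree P Q
      disagreement⊆ i e with i Finₚ.≟ y | i Finₚ.≟ x | i Finₚ.≟ z
      ... | yes refl | _        | _        with () ← trans (sym e) agree-at-y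
      ... | no _     | yes refl | _        with () ← trans (sym e) agree-at-x
      ... | no _     | no _     | yes refl = disagree-at-z
      ... | no i≢y   | no i≢x   | no i≢z   =
        subst (λ j → not (does (j Finₚ.≟ P i)) ≡ true) (link-other i≢x i≢y i≢z) e

  inessential⇒exposed-within : ∀ {P w} → IsMatching P → Inessential w →
    ∃ λ Q → IsMaximumMatching Q × Q w ≡ w × (∀ i → Q i ≡ i → i ≢ w → P i ≡ i)
  inessential⇒exposed-within {P} {w} P-matching (Q₀ , Q₀-maximum , Q₀w≡w) =
    go (<-wellFounded (count (disagree P Q₀))) Q₀-maximum Q₀w≡w
    where
    go : ∀ {Q} → Acc _<_ (count (disagree P Q)) → IsMaximumMatching Q → Q w ≡ w →
      ∃ λ Q → IsMaximumMatching Q × Q w ≡ w × (∀ i → Q i ≡ i → i ≢ w → P i ≡ i)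
    go {Q} (acc closer) Q-maximum Qw≡w
      with Finₚ.any? (λ x → (Q x Finₚ.≟ x) ×-dec (¬? (P x Finₚ.≟ x) ×-dec ¬? (x Finₚ.≟ w)))
    ... | no ∄x = Q , Q-maximum , Qw≡w ,
      λ i Qi≡i i≢w → decidable-stable (P i Finₚ.≟ i) (λ Pi≢i → ∄x (i , Qi≡i , Pi≢i , i≢w))
    ... | yes (x , Qx≡x , Px≢x , x≢w) with Q (P x) Finₚ.≟ P x
    ...   | yes QPx≡Px = ⊥-elim (maximum-matching-no-exposed-edge Q-maximum Qx≡x QPx≡Px
                                   (IsMatching.adjacent P-matching x Px≢x))
    ...   | no QPx≢Px =
      go (closer exchange-closer) exchange-maximum (exchange-keeps-exposed Qw≡w (x≢w ∘ sym))
      where open Exchange P-matching Q-maximum Qx≡x Px≢x QPx≢Px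

  module _ (all-inessential : ∀ w → Inessential w) where

    -- Gallai's lemma, by induction on the walk u, w, …, v.  Take a maximum matching Q missing w
    -- whose other exposed vertices are exposed by P.  Q covers u, since u and w are adjacent; if Q
    -- also covered v it would expose fewer vertices than P, so Q exposes v and the walk from w is
    -- shorter.
    two-exposed⇒disconnected : ∀ {C P u v} → IsMaximumMatching P → P u ≡ u → P v ≡ v → u ≢ v →
      WalkIn G C u v → ⊥
    two-exposed⇒disconnected P-maximum Pu≡u Pv≡v u≢v (here _) = u≢v refl
    two-exposed⇒disconnected {P = P} {u} {v} P-maximum Pu≡u Pv≡v u≢v (step {v = w} _ uw walk)
      with w Finₚ.≟ v | P w Finₚ.≟ w
    ... | yes refl | _        = maximum-matching-no-exposed-edge P-maximum Pu≡u Pv≡v uw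
    ... | no _     | yes Pw≡w = maximum-matching-no-exposed-edge P-maximum Pu≡u Pw≡w uw
    ... | no w≢v   | no Pw≢w
      with inessential⇒exposed-within (IsMaximumMatching.isMatching P-maximum) (all-inessential w)
    ...   | Q , Q-maximum , Qw≡w , Q-exposed⇒P-exposed with Q u Finₚ.≟ u | Q v Finₚ.≟ v
    ...     | yes Qu≡u | _        = maximum-matching-no-exposed-edge Q-maximum Qu≡u Qw≡w uw
    ...     | no _     | yes Qv≡v = two-exposed⇒disconnected Q-maximum Qw≡w Qv≡v w≢v walk
    ...     | no Qu≢u  | no Qv≢v  =
      <⇒≱ fewer-exposed (IsMaximumMatching.maximum P-maximum (IsMaximumMatching.isMatching Q-maximum))
      where
      P-u = remove (fixed P) u
      exposed⊆ : remove (fixed Q) w ⊆ᵇ remove P-u v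
      exposed⊆ i e with remove⁻ (fixed Q) w e
      ... | Qi , i≢w =
        remove⁺ P-u v (remove⁺ (fixed P) u Pi (λ { refl → Qu≢u Qi≡i })) (λ { refl → Qv≢v Qi≡i })
        where
        Qi≡i = does-true⁻ (Q i Finₚ.≟ i) Qi
        Pi = dec-true (P i Finₚ.≟ i) (Q-exposed⇒P-exposed i Qi≡i i≢w)
      fewer-exposed : deficiency Q < deficiency P
      fewer-exposed = begin-strict
        count (fixed Q)                   ≤⟨ count-remove-≤ (fixed Q) w ⟩
        suc (count (remove (fixed Q) w))  ≤⟨ s≤s (count-mono _ _ exposed⊆) ⟩
        suc (count (remove P-u v))        <⟨ n<1+n _ ⟩
        suc (suc (count (remove P-u v)))  ≡⟨ cong suc (count-remove P-u v∈P-u) ⟨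
        suc (count P-u)                   ≡⟨ count-remove (fixed P) (dec-true (P u Finₚ.≟ u) Pu≡u) ⟨
        count (fixed P)                   ∎
        where
        open ≤-Reasoning
        v∈P-u = remove⁺ (fixed P) u (dec-true (P v Finₚ.≟ v) Pv≡v) (u≢v ∘ sym)

    component-factor-critical : ∀ {C} → IsComponent G C → FactorCritical G C
    component-factor-critical {C} (_ , connected , closed) x x∈C = Q , perfect
      where
      Q = proj₁ (all-inessential x)
      Q-maximum = proj₁ (proj₂ (all-inessential x))
      Qx≡x = proj₂ (proj₂ (all-inessential x))
      module Q = IsMaximumMatching Q-maximum
      perfect : ∀ w → w ∈ C - x → (Q w ∈ C - x) × adj G w (Q w) ≡ true × Q (Q w) ≡ w
      perfect w w∈C-x = x∈p∧x≢y⇒x∈p-y (closed w (Q w) w∈C w~Qw) Qw≢x , w~Qw , Q.involutive w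
        where
        w∈C = p─q⊆p C ⁅ x ⁆ w∈C-x
        w≢x = x∈p-y⇒x≢y w∈C-x
        Qw≢w : Q w ≢ w
        Qw≢w Qw≡w = two-exposed⇒disconnected Q-maximum Qw≡w Qx≡x w≢x (connected w x w∈C x∈C)
        w~Qw = Q.adjacent w Qw≢w
        Qw≢x : Q w ≢ x
        Qw≢x Qw≡x = w≢x (trans (sym (Q.involutive w)) (trans (cong Q Qw≡x) Qx≡x))

  -- Factor-critical subgraphs

  perfect-matching⇒even : ∀ {W} → PerfectMatching G W → ∃ λ h → ∣ W ∣ ≡ h + h
  perfect-matching⇒even {W} (m , perfect) = h , (begin
    ∣ W ∣                                              ≡⟨ ∣p∣≡count-lookup W ⟩
    count (lookup W)                                   ≡⟨ +-identityʳ _ ⟨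
    count (lookup W) + 0                               ≡⟨ cong (count (lookup W) +_) no-fixed-point ⟨
    count (lookup W) + count (λ i → lookup W i ∧ fixed m′ i)
      ≡⟨ count-lower-twice m′-involutive (lookup W) W-closed ⟨
    h + h                                              ∎)
    where
    open ≡-Reasoning
    m′ : Fin (n G) → Fin (n G)
    m′ i with i ∈? W
    ... | yes _ = m i
    ... | no  _ = i
    m′-in : ∀ {i} → i ∈ W → m′ i ≡ m i
    m′-in {i} i∈W with i ∈? W
    ... | yes _   = refl
    ... | no  i∉W = ⊥-elim (i∉W i∈W)
    m′-involutive : Involutive m′
    m′-involutive i with i ∈? W
    ... | yes i∈W = let mi∈W , _ , mmi≡i = perfect i i∈W in trans (m′-in mi∈W) mmi≡i
    ... | no  i∉W with i ∈? W
    ...   | yes i∈W = ⊥-elim (i∉W i∈W)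
    ...   | no  _   = refl
    W-closed : ∀ i → lookup W (m′ i) ≡ lookup W i
    W-closed i with i ∈? W
    ... | yes i∈W = trans ([]=⇒lookup (proj₁ (perfect i i∈W))) (sym ([]=⇒lookup i∈W))
    ... | no  _   = refl
    no-fixed-point : count (λ i → lookup W i ∧ fixed m′ i) ≡ 0
    no-fixed-point = trans (count-cong no-fixed-point-at) (count-const-false (n G))
      where
      no-fixed-point-at : ∀ i → lookup W i ∧ fixed m′ i ≡ false
      no-fixed-point-at i with lookup W i in e
      ... | false = refl
      ... | true  = dec-false (m′ i Finₚ.≟ i) λ m′i≡i → let i∈W = lookup⇒[]= i W e in
        adj⇒≢ (proj₁ (proj₂ (perfect i i∈W))) (trans (sym m′i≡i) (m′-in i∈W))
    h = count (λ i → lookup W i ∧ lower m′ i)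

  factor-critical⇒odd : ∀ {C x} → FactorCritical G C → x ∈ C → ∣ C ∣ % 2 ≡ 1
  factor-critical⇒odd {C} {x} fc x∈C with perfect-matching⇒even (fc x x∈C)
  ... | h , ∣C-x∣≡h+h = begin
    ∣ C ∣ % 2         ≡⟨ cong (_% 2) (∣p∣≡1+∣p-x∣ x∈C) ⟩
    suc ∣ C - x ∣ % 2 ≡⟨ cong (λ k → suc k % 2) ∣C-x∣≡h+h ⟩
    suc (h + h) % 2   ≡⟨ 1+h+h%2≡1 h ⟩
    1                 ∎
    where
    open ≡-Reasoning
    1+h+h%2≡1 : ∀ h → suc (h + h) % 2 ≡ 1
    1+h+h%2≡1 zero    = refl
    1+h+h%2≡1 (suc h) rewrite +-suc h h = 1+h+h%2≡1 h

  factor-critical⇒order≢3 : TriangleFree G → ∀ {C} → FactorCritical G C → ∣ C ∣ ≢ 3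
  factor-critical⇒order≢3 triangle-free {C} fc ∣C∣≡3
    with nonempty C (subst (0 <_) (sym ∣C∣≡3) (s≤s z≤n))
  ... | x , x∈C with nonempty (C - x) (subst (0 <_) (suc-injective (trans (sym ∣C∣≡3) (∣p∣≡1+∣p-x∣ x∈C)))
                                              (s≤s z≤n))
  ... | y , y∈C-x = triangle-free x y z x~y y~z x~z
    where
    neighbour-in : ∀ {u w} → u ∈ C → w ∈ C - u → ∃ λ v → v ∈ C - u × adj G w v ≡ true
    neighbour-in {u} {w} u∈C w∈C-u =
      let m , perfect = fc u u∈C ; mw∈C-u , w~mw , _ = perfect w w∈C-u in m w , mw∈C-u , w~mw
    z = proj₁ (neighbour-in x∈C y∈C-x)
    z∈C-x = proj₁ (proj₂ (neighbour-in x∈C y∈C-x))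
    y~z = proj₂ (proj₂ (neighbour-in x∈C y∈C-x))
    only-z : ∀ {w} → w ∈ C → w ≢ x → w ≢ y → w ≡ z
    only-z = ∣p∣≡3⇒third-element x∈C y∈C-x (x∈p∧x≢y⇒x∈p-y z∈C-x (adj⇒≢ y~z ∘ sym)) ∣C∣≡3
    x~z : adj G x z ≡ true
    x~z with neighbour-in (p─q⊆p C ⁅ x ⁆ y∈C-x) (x∈p∧x≢y⇒x∈p-y x∈C (x∈p-y⇒x≢y y∈C-x ∘ sym))
    ... | v , v∈C-y , x~v = subst (λ v → adj G x v ≡ true)
      (only-z (p─q⊆p C ⁅ y ⁆ v∈C-y) (adj⇒≢ x~v ∘ sym) (x∈p-y⇒x≢y v∈C-y)) x~v
    x~y : adj G x y ≡ true
    x~y with neighbour-in (p─q⊆p C ⁅ x ⁆ z∈C-x) (x∈p∧x≢y⇒x∈p-y x∈C (x∈p-y⇒x≢y z∈C-x ∘ sym))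
    ... | v , v∈C-z , x~v = subst (λ v → adj G x v ≡ true)
      (decidable-stable (v Finₚ.≟ y) (λ v≢y → x∈p-y⇒x≢y v∈C-z
        (only-z (p─q⊆p C ⁅ z ⁆ v∈C-z) (adj⇒≢ x~v ∘ sym) v≢y))) x~v

  -- Stability and clique cover numbers

  stable? : ∀ U S → Dec (StableIn G U S)
  stable? U S = (S ⊆? U) ×-dec Finₚ.all? λ u → Finₚ.all? λ v →
    (u ∈? S) →-dec ((v ∈? S) →-dec (adj G u v Bool.≟ false))

  alpha-exists : ∀ U → ∃ (IsAlpha G U)
  alpha-exists U
    with maximal (λ j → anySubset? λ S → stable? U S ×-dec (∣ S ∣ ℕ.≟ j)) (n G)
                 (λ j (S , _ , ∣S∣≡j) → subst (_≤ n G) ∣S∣≡j (∣p∣≤n S))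
                 (∅ , (⊆-min U , λ _ _ u∈∅ _ → ⊥-elim (∉⊥ u∈∅)) , ∣⊥∣≡0 (n G))
  ... | a , stable , maximum = a , stable , λ S S-stable → maximum ∣ S ∣ (S , S-stable , refl)

  clique-partition? : ∀ U k → Dec (CliquePartition G U k)
  clique-partition? U zero with Finₚ.any? (_∈? U)
  ... | yes (u , u∈U) = no λ (c , _) → Finₚ.¬Fin0 (c u u∈U)
  ... | no ∄u         = yes ((λ u u∈U → ⊥-elim (∄u (u , u∈U))) , λ u _ u∈U _ _ _ → ⊥-elim (∄u (u , u∈U)))
  clique-partition? U (suc k) = map′ partition labelling (any-function? (n G) cliques-resp cliques?)
    where
    CliquesOn : (Fin (n G) → Fin (suc k)) → Set
    CliquesOn f = ∀ u v → u ∈ U → v ∈ U → u ≢ v → f u ≡ f v → adj G u v ≡ true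
    cliques-resp : ∀ {f g} → f ≗ g → CliquesOn f → CliquesOn g
    cliques-resp f≗g f-cliques u v u∈U v∈U u≢v gu≡gv =
      f-cliques u v u∈U v∈U u≢v (trans (f≗g u) (trans gu≡gv (sym (f≗g v))))
    cliques? : ∀ f → Dec (CliquesOn f)
    cliques? f = Finₚ.all? λ u → Finₚ.all? λ v → (u ∈? U) →-dec ((v ∈? U) →-dec
      (¬? (u Finₚ.≟ v) →-dec ((f u Finₚ.≟ f v) →-dec (adj G u v Bool.≟ true))))
    partition : ∃ CliquesOn → CliquePartition G U (suc k)
    partition (f , f-cliques) = (λ u _ → f u) , f-cliques
    labelling : CliquePartition G U (suc k) → ∃ CliquesOn
    labelling (c , c-cliques) = f , λ u v u∈U v∈U u≢v fu≡fv →
      let u∈U′ , fu≡c = f-spec u∈U ; v∈U′ , fv≡c = f-spec v∈U in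
      c-cliques u v u∈U′ v∈U′ u≢v (trans (sym fu≡c) (trans fu≡fv fv≡c))
      where
      f : Fin (n G) → Fin (suc k)
      f u with u ∈? U
      ... | yes u∈U = c u u∈U
      ... | no  _   = zero
      f-spec : ∀ {u} → u ∈ U → Σ (u ∈ U) λ u∈U → f u ≡ c u u∈U
      f-spec {u} u∈U with u ∈? U
      ... | yes u∈U′ = u∈U′ , refl
      ... | no  u∉U  = ⊥-elim (u∉U u∈U)

  theta-exists : ∀ U → ∃ (IsTheta G U)
  theta-exists U = minimal (clique-partition? U) singletons
    where
    singletons : CliquePartition G U (n G)
    singletons = (λ u _ → u) , λ _ _ _ _ u≢v u≡v → ⊥-elim (u≢v u≡v)

  alpha-mono : ∀ {U V a b} → U ⊆ V → IsAlpha G U a → IsAlpha G V b → a ≤ b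
  alpha-mono U⊆V ((S , (S⊆U , S-stable) , ∣S∣≡a) , _) (_ , maximum) =
    subst (_≤ _) ∣S∣≡a (maximum S ((λ u∈S → U⊆V (S⊆U u∈S)) , S-stable))

  isolated-vertex-raises-alpha : ∀ {x a a′} → (∀ y → adj G x y ≡ false) →
    IsAlpha G ⊤ a → IsAlpha G (⊤ - x) a′ → suc a′ ≤ a
  isolated-vertex-raises-alpha {x} {a} {a′} isolated (_ , maximum) ((S , (S⊆⊤-x , S-stable) , ∣S∣≡a′) , _) =
    begin
    suc a′        ≡⟨ cong suc ∣S∣≡a′ ⟨
    suc ∣ S ∣     ≤⟨ p⊂q⇒∣p∣<∣q∣ (p⊆p∪q ⁅ x ⁆ , x , q⊆p∪q S ⁅ x ⁆ (x∈⁅x⁆ x) , x∉S) ⟩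
    ∣ S ∪ ⁅ x ⁆ ∣ ≤⟨ maximum (S ∪ ⁅ x ⁆) ((λ _ → ∈⊤) , S+x-stable) ⟩
    a             ∎
    where
    open ≤-Reasoning
    x∉S : x ∉ S
    x∉S x∈S = x∈p-y⇒x≢y (S⊆⊤-x x∈S) refl
    x-isolated : ∀ {u} v → u ∈ ⁅ x ⁆ → adj G u v ≡ false
    x-isolated v u∈⁅x⁆ rewrite x∈⁅y⁆⇒x≡y x u∈⁅x⁆ = isolated v
    S+x-stable : ∀ u v → u ∈ S ∪ ⁅ x ⁆ → v ∈ S ∪ ⁅ x ⁆ → adj G u v ≡ false
    S+x-stable u v u∈ v∈ with x∈p∪q⁻ S ⁅ x ⁆ u∈ | x∈p∪q⁻ S ⁅ x ⁆ v∈
    ... | inj₂ u∈⁅x⁆ | _          = x-isolated v u∈⁅x⁆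
    ... | inj₁ _     | inj₂ v∈⁅x⁆ = trans (Graph.sym G u v) (x-isolated u v∈⁅x⁆)
    ... | inj₁ u∈S   | inj₁ v∈S   = S-stable u v u∈S v∈S

  IsCliqueLabelling : ∀ {k} → (Fin (n G) → Fin k) → Set
  IsCliqueLabelling ℓ = ∀ u v → u ≢ v → ℓ u ≡ ℓ v → adj G u v ≡ true

  clique-labelling⇒partition : ∀ {k} {ℓ : Fin (n G) → Fin k} → IsCliqueLabelling ℓ → CliquePartition G ⊤ k
  clique-labelling⇒partition {ℓ = ℓ} ℓ-cliques = (λ u _ → ℓ u) , λ u v _ _ → ℓ-cliques u v

  extend-clique-partition : ∀ {x k} → CliquePartition G (⊤ - x) k →
    Σ (Fin (n G) → Fin (suc k)) λ ℓ → IsCliqueLabelling ℓ × (∀ y → y ≢ x → ℓ y ≢ ℓ x)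
  extend-clique-partition {x} {k} (c , c-cliques) = ℓ , ℓ-cliques , lonely
    where
    label : ∀ u → Dec (u ≡ x) → Fin (suc k)
    label u (yes _)  = Fin.fromℕ k
    label u (no u≢x) = Fin.inject₁ (c u (x∈p∧x≢y⇒x∈p-y ∈⊤ u≢x))
    ℓ : Fin (n G) → Fin (suc k)
    ℓ u = label u (u Finₚ.≟ x)
    ℓ-cliques : IsCliqueLabelling ℓ
    ℓ-cliques u v u≢v with u Finₚ.≟ x | v Finₚ.≟ x
    ... | yes u≡x | yes v≡x = ⊥-elim (u≢v (trans u≡x (sym v≡x)))
    ... | yes _   | no _    = ⊥-elim ∘ Finₚ.fromℕ≢inject₁
    ... | no _    | yes _   = ⊥-elim ∘ Finₚ.fromℕ≢inject₁ ∘ sym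
    ... | no _    | no _    = c-cliques u v _ _ u≢v ∘ Finₚ.inject₁-injective
    lonely : ∀ y → y ≢ x → ℓ y ≢ ℓ x
    lonely y y≢x with y Finₚ.≟ x | x Finₚ.≟ x
    ... | yes y≡x | _      = ⊥-elim (y≢x y≡x)
    ... | no _    | yes _  = Finₚ.fromℕ≢inject₁ ∘ sym
    ... | no _    | no x≢x = ⊥-elim (x≢x refl)

  theta≤1+theta-deletion : ∀ {x t t′} → IsTheta G ⊤ t → IsTheta G (⊤ - x) t′ → t ≤ suc t′
  theta≤1+theta-deletion (_ , minimum) (partition′ , _) =
    minimum _ (clique-labelling⇒partition (proj₁ (proj₂ (extend-clique-partition partition′))))

  representative : (Fin (n G) → Fin (n G)) → Fin (n G) → Fin (n G)
  representative m i = if lower m i then i else m i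

  representative-lower : ∀ {m} → Involutive m → ∀ i → lower m (representative m i) ≡ true
  representative-lower {m} m-inv i with lower m i in e
  ... | true  = e
  ... | false rewrite m-inv i = dec-true (m i Finₚ.≤? i) (<⇒≤ (≰⇒> (does-false⁻ (i Finₚ.≤? m i) e)))

  representative-cases : ∀ m i → representative m i ≡ i ⊎ representative m i ≡ m i
  representative-cases m i with lower m i
  ... | true  = inj₁ refl
  ... | false = inj₂ refl

  same-representative⇒adjacent : ∀ {m u v} → IsMatching m → u ≢ v →
    representative m u ≡ representative m v → adj G u v ≡ true
  same-representative⇒adjacent {m} {u} {v} M u≢v ru≡rv
    with representative-cases m u | representative-cases m v
  ... | inj₁ ru≡u  | inj₁ rv≡v  = ⊥-elim (u≢v (trans (sym ru≡u) (trans ru≡rv rv≡v)))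
  ... | inj₁ ru≡u  | inj₂ rv≡mv = adj-sym (subst (λ w → adj G v w ≡ true) mv≡u
                                   (IsMatching.adjacent M v (λ mv≡v → u≢v (trans (sym mv≡u) mv≡v))))
    where mv≡u = trans (sym rv≡mv) (trans (sym ru≡rv) ru≡u)
  ... | inj₂ ru≡mu | inj₁ rv≡v  = subst (λ w → adj G u w ≡ true) mu≡v
                                   (IsMatching.adjacent M u (λ mu≡u → u≢v (trans (sym mu≡u) mu≡v)))
    where mu≡v = trans (sym ru≡mu) (trans ru≡rv rv≡v)
  ... | inj₂ ru≡mu | inj₂ rv≡mv = ⊥-elim (u≢v (trans (sym (IsMatching.involutive M u))
    (trans (cong m (trans (sym ru≡mu) (trans ru≡rv rv≡mv))) (IsMatching.involutive M v))))

  matching⇒clique-labelling : ∀ {m} → IsMatching m →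
    Σ (Fin (n G) → Fin (count (lower m))) IsCliqueLabelling
  matching⇒clique-labelling {m} M = ℓ , λ u v u≢v ℓu≡ℓv → same-representative⇒adjacent M u≢v
    (rank-injective (lower m) (rep-lower u) (rep-lower v)
      (Finₚ.fromℕ<-injective _ _ (rank<rep u) (rank<rep v) ℓu≡ℓv))
    where
    rep-lower = representative-lower (IsMatching.involutive M)
    rank<rep : ∀ i → rank (lower m) (representative m i) < count (lower m)
    rank<rep i = rank<count (lower m) {representative m i} (rep-lower i)
    ℓ : Fin (n G) → Fin (count (lower m))
    ℓ i = Fin.fromℕ< (rank<rep i)

  -- In a triangle-free graph every label class has at most two vertices; pairing them is a matching.
  module _ (triangle-free : TriangleFree G) {k} {ℓ : Fin (n G) → Fin k}
           (ℓ-cliques : IsCliqueLabelling ℓ) where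
    private
      Mate : Fin (n G) → Fin (n G) → Set
      Mate i j = j ≢ i × ℓ j ≡ ℓ i

      mate? : ∀ i → Dec (∃ (Mate i))
      mate? i = Finₚ.any? λ j → ¬? (j Finₚ.≟ i) ×-dec (ℓ j Finₚ.≟ ℓ i)

      choose : ∀ {i} → Dec (∃ (Mate i)) → Fin (n G)
      choose     (yes (j , _)) = j
      choose {i} (no _)        = i

      mate-unique : ∀ {i j j′} → Mate i j → Mate i j′ → j ≡ j′
      mate-unique {i} {j} {j′} (j≢i , ℓj≡ℓi) (j′≢i , ℓj′≡ℓi) = decidable-stable (j Finₚ.≟ j′) λ j≢j′ →
        triangle-free i j j′ (ℓ-cliques i j (j≢i ∘ sym) (sym ℓj≡ℓi))
                             (ℓ-cliques j j′ j≢j′ (trans ℓj≡ℓi (sym ℓj′≡ℓi)))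
                             (ℓ-cliques i j′ (j′≢i ∘ sym) (sym ℓj′≡ℓi))

    mate : Fin (n G) → Fin (n G)
    mate i = choose (mate? i)

    private
      mate-cases : ∀ i → Mate i (mate i) ⊎ (mate i ≡ i × ∀ j → ¬ Mate i j)
      mate-cases i with mate? i
      ... | yes (_ , i-mate) = inj₁ i-mate
      ... | no ∄j            = inj₂ (refl , λ j i-mate → ∄j (j , i-mate))

      mate-of-mate : ∀ {i j} → Mate i j → mate i ≡ j
      mate-of-mate {i} Mij with mate-cases i
      ... | inj₁ Mi-mate  = mate-unique Mi-mate Mij
      ... | inj₂ (_ , ∄j) = ⊥-elim (∄j _ Mij)

    mate-isMatching : IsMatching mate
    mate-isMatching = record { involutive = involutive ; adjacent = adjacent }
      where
      involutive : Involutive mate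
      involutive i with mate-cases i
      ... | inj₁ (j≢i , ℓj≡ℓi) = mate-of-mate ((j≢i ∘ sym) , sym ℓj≡ℓi)
      ... | inj₂ (mi≡i , _)    = trans (cong mate mi≡i) mi≡i
      adjacent : ∀ i → mate i ≢ i → adj G i (mate i) ≡ true
      adjacent i mi≢i with mate-cases i
      ... | inj₁ (j≢i , ℓj≡ℓi) = ℓ-cliques i (mate i) (j≢i ∘ sym) (sym ℓj≡ℓi)
      ... | inj₂ (mi≡i , _)    = ⊥-elim (mi≢i mi≡i)

    mate-of-lonely : ∀ {x} → (∀ y → y ≢ x → ℓ y ≢ ℓ x) → mate x ≡ x
    mate-of-lonely {x} lonely with mate-cases x
    ... | inj₁ (y≢x , ℓy≡ℓx) = ⊥-elim (lonely (mate x) y≢x ℓy≡ℓx)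
    ... | inj₂ (mx≡x , _)    = mx≡x

    count-lower-mate≤labels : count (lower mate) ≤ k
    count-lower-mate≤labels =
      injective-on⇒count≤ k (lower mate) (Fin.toℕ ∘ ℓ) (λ i _ → Finₚ.toℕ<n (ℓ i)) injective
      where
      injective : ∀ i j → lower mate i ≡ true → lower mate j ≡ true → Fin.toℕ (ℓ i) ≡ Fin.toℕ (ℓ j) → i ≡ j
      injective i j i-lower j-lower ℓi≡ℓj = decidable-stable (i Finₚ.≟ j) λ i≢j →
        let mi≡j = mate-of-mate {i} ((i≢j ∘ sym) , sym (Finₚ.toℕ-injective ℓi≡ℓj))
            mj≡i = mate-of-mate {j} (i≢j , Finₚ.toℕ-injective ℓi≡ℓj)
        in i≢j (Finₚ.≤-antisym (subst (i Fin.≤_) mi≡j (does-true⁻ (i Finₚ.≤? mate i) i-lower))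
                               (subst (j Fin.≤_) mj≡i (does-true⁻ (j Finₚ.≤? mate j) j-lower)))

  -- Gap-critical graphs

  deletion-lowers-gap : GapCritical G → ∀ x {t a t′ a′} → IsTheta G ⊤ t → IsAlpha G ⊤ a →
    IsTheta G (⊤ - x) t′ → IsAlpha G (⊤ - x) a′ → t′ + a < t + a′
  deletion-lowers-gap gap-critical x {t} {a} {t′} {a′} θ α θ′ α′ =
    -<-⇒+<+ {t} {a} {t′} {a′} (gap-critical (⊤ - x) ⊤⊈⊤-x _ _ (_ , _ , θ , α , refl) (_ , _ , θ′ , α′ , refl))
    where
    ⊤⊈⊤-x : ¬ (⊤ ⊆ ⊤ - x)
    ⊤⊈⊤-x ⊤⊆⊤-x = x∈p-y⇒x≢y (⊤⊆⊤-x ∈⊤) refl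

  gap-critical⇒inessential : TriangleFree G → GapCritical G → ∀ x → Inessential x
  gap-critical⇒inessential triangle-free gap-critical x
    with theta-exists ⊤ | alpha-exists ⊤ | theta-exists (⊤ - x) | alpha-exists (⊤ - x)
  ... | t , θ | a , α | t′ , θ′ | a′ , α′ = Q , Q-maximum , mate-of-lonely triangle-free ℓ-cliques lonely
    where
    extension = extend-clique-partition (proj₁ θ′)
    ℓ-cliques = proj₁ (proj₂ extension)
    lonely = proj₂ (proj₂ extension)
    Q = mate triangle-free ℓ-cliques
    Q-matching = mate-isMatching triangle-free ℓ-cliques
    t′<t : t′ < t
    t′<t = +-cancelʳ-< a t′ t (<-≤-trans (deletion-lowers-gap gap-critical x θ α θ′ α′)
                                         (+-monoʳ-≤ t (alpha-mono (p─q⊆p ⊤ ⁅ x ⁆) α′ α)))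
    t≤lower : ∀ {P} → IsMatching P → t ≤ count (lower P)
    t≤lower P-matching = proj₂ θ _ (clique-labelling⇒partition (proj₂ (matching⇒clique-labelling P-matching)))
    Q-lower≤t = ≤-trans (count-lower-mate≤labels triangle-free ℓ-cliques) t′<t
    Q-maximum : IsMaximumMatching Q
    Q-maximum = record { isMatching = Q-matching ; maximum = λ {P} P-matching → +-cancelˡ-≤ (n G) _ _ (begin
      n G + deficiency Q                ≡⟨ count-lower+count-lower (IsMatching.involutive Q-matching) ⟨
      count (lower Q) + count (lower Q) ≤⟨ +-mono-≤ Q-lower≤t Q-lower≤t ⟩
      t + t                             ≤⟨ +-mono-≤ (t≤lower P-matching) (t≤lower P-matching) ⟩
      count (lower P) + count (lower P) ≡⟨ count-lower+count-lower (IsMatching.involutive P-matching) ⟩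
      n G + deficiency P                ∎) }
      where open ≤-Reasoning

  gap-critical⇒has-neighbour : GapCritical G → ∀ x → ∃ λ y → adj G x y ≡ true
  gap-critical⇒has-neighbour gap-critical x with Finₚ.any? (λ y → adj G x y Bool.≟ true)
  ... | yes neighbour = neighbour
  ... | no ∄y with theta-exists ⊤ | alpha-exists ⊤ | theta-exists (⊤ - x) | alpha-exists (⊤ - x)
  ...   | t , θ | a , α | t′ , θ′ | a′ , α′ =
    ⊥-elim (<⇒≱ (deletion-lowers-gap gap-critical x θ α θ′ α′) (begin
    t + a′      ≤⟨ +-monoˡ-≤ a′ (theta≤1+theta-deletion θ θ′) ⟩
    suc t′ + a′ ≡⟨ +-suc t′ a′ ⟨
    t′ + suc a′ ≤⟨ +-monoʳ-≤ t′ (isolated-vertex-raises-alpha isolated α α′) ⟩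
    t′ + a      ∎))
    where
    open ≤-Reasoning
    isolated : ∀ y → adj G x y ≡ false
    isolated y with adj G x y in x~y
    ... | true  = ⊥-elim (∄y (y , x~y))
    ... | false = refl

odd≥2≢3⇒≥5 : ∀ {c} → c % 2 ≡ 1 → 2 ≤ c → c ≢ 3 → 5 ≤ c
odd≥2≢3⇒≥5 {1} _ (s≤s ()) _
odd≥2≢3⇒≥5 {2} () _ _
odd≥2≢3⇒≥5 {3} _ _ c≢3 = ⊥-elim (c≢3 refl)
odd≥2≢3⇒≥5 {4} () _ _
odd≥2≢3⇒≥5 {suc (suc (suc (suc (suc c))))} _ _ _ = s≤s (s≤s (s≤s (s≤s (s≤s z≤n))))

proposition3p11 : (G : Graph) → TriangleFree G → GapCritical G →
    ∀ C → IsComponent G C → FactorCritical G C × ∣ C ∣ % 2 ≡ 1 × 5 ≤ ∣ C ∣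
proposition3p11 G triangle-free gap-critical C component@((x , x∈C) , _ , closed) =
  factor-critical , odd , odd≥2≢3⇒≥5 odd 2≤∣C∣ (factor-critical⇒order≢3 G triangle-free factor-critical)
  where
  factor-critical =
    component-factor-critical G (gap-critical⇒inessential G triangle-free gap-critical) component
  odd = factor-critical⇒odd G factor-critical x∈C
  y = proj₁ (gap-critical⇒has-neighbour G gap-critical x)
  x~y = proj₂ (gap-critical⇒has-neighbour G gap-critical x)
  y∈C-x = x∈p∧x≢y⇒x∈p-y (closed x y x∈C x~y) (adj⇒≢ G x~y ∘ sym)
  2≤∣C∣ : 2 ≤ ∣ C ∣
  2≤∣C∣ = subst (2 ≤_) (sym (∣p∣≡1+∣p-x∣ x∈C)) (s≤s (subst (1 ≤_) (sym (∣p∣≡1+∣p-x∣ y∈C-x)) (s≤s z≤n)))
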